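{- Let $G=(V,E)$ be a finite simple undirected graph. Let $G_0:=G$ and let $W_1,\dots,W_r$ be distinct subsets of $V$ such that for every $t\in\{1,\dots,r\}$, $W_t$ is a clique of $G_{t-1}$ with $|W_t|\ge2$ and $G_t:=G_{t-1}\mid W_t$. Suppose there is $k>0$ such that for every $t\in\{1,\dots,r\}$, $|W_t|=k$ and the subgraph of $G_{t-1}$ induced by $\bigcup_{i=1}^tW_i$ is $k$-partite with vertex classes $V_t^1,\dots,V_t^k$. Then for every $t\in\{1,\dots,r\}$, $|W_\ell\cap V_t^i|=1$ for all $\ell\in\{1,\dots,t\}$ and $i\in\{1,\dots,k\}$.
   Context: For a graph $H=(V,E_H)$ and a clique $W$ of $H$ with $|W|\ge2$, the clique projection is $H\mid W=(V,E_H\cup\{uv\notin E_H\mid u\ne v,\ W\subseteq N_H(u)\cup N_H(v)\})$, where $N_H(u)$ is the neighborhood of $u$ in $H$. A graph is $k$-partite with vertex classes $V^1,\dots,V^k$ if its vertex set is partitioned into the stable sets $V^1,\dots,V^k$. -}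

module Defs where

open import Level using (0ℓ)
open import Data.Nat using (ℕ; zero; suc; _≤_)
open import Data.Fin using (Fin)
open import Data.Fin.Subset using (Subset; _∈_)
open import Data.Product using (Σ; _×_; ∃)
open import Data.Sum using (_⊎_)
open import Relation.Nullary using (¬_)
open import Relation.Binary using (Rel)
open import Relation.Binary.PropositionalEquality using (_≡_; _≢_)

Graph : ℕ → Set₁
Graph n = Rel (Fin n) 0ℓ

IsSimple : ∀ {n} → Graph n → Set
IsSimple {n} E = (∀ (u v : Fin n) → E u v → E v u) × (∀ (u : Fin n) → ¬ E u u)

IsClique : ∀ {n} → Graph n → Subset n → Set
IsClique {n} E W = ∀ (u v : Fin n) → u ∈ W → v ∈ W → u ≢ v → E u v

_∣ᶜ_ : ∀ {n} → Graph n → Subset n → Graph n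
(E ∣ᶜ W) u v = E u v ⊎ ((u ≢ v) × (∀ w → w ∈ W → E u w ⊎ E v w))

-- G_0 = G, G_t = G_{t-1} | W_t   (W indexed from 1 as in the paper; W 0 unused)
iterProj : ∀ {n} → Graph n → (ℕ → Subset n) → ℕ → Graph n
iterProj G W zero = G
iterProj G W (suc t) = iterProj G W t ∣ᶜ W (suc t)

InUnion : ∀ {n} → (ℕ → Subset n) → ℕ → Fin n → Set
InUnion W t u = ∃ λ i → (1 ≤ i) × (i ≤ t) × (u ∈ W i)

IsKPartiteInduced : ∀ {n} (k : ℕ) → Graph n → (Fin n → Set) → (Fin k → Subset n) → Set
IsKPartiteInduced {n} k H U P =
    (∀ (u : Fin n) → U u → ∃ λ i → u ∈ P i)
  × (∀ (i : Fin k) (u : Fin n) → u ∈ P i → U u)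
  × (∀ (i j : Fin k) (u : Fin n) → u ∈ P i → u ∈ P j → i ≡ j)
  × (∀ (i : Fin k) (u v : Fin n) → u ∈ P i → v ∈ P i → ¬ H u v)

-- Each W ℓ with ℓ ≤ t is a clique of G_{ℓ-1}, hence of its supergraph G_{t-1}, so it meets
-- each of the k stable classes V_t^i in at most one vertex. The classes cover W ℓ and
-- |W ℓ| = k, so by pigeonhole none of the k intersections can be empty.
module Submission where

open import Defs
open import Data.Nat using (ℕ; zero; suc; _≤_; _<_; _∸_; _+_; z≤n; _≤′_; ≤′-refl; ≤′-step)
open import Data.Nat.Properties
  using (≤-antisym; ≤-reflexive; +-suc; +-mono-≤; +-monoʳ-≤; +-cancelʳ-≤;  ∸-monoˡ-≤; +-0-commutativeMonoid; ≤-trans; ≤⇒≤′; module ≤-Reasoning)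
open import Algebra.Properties.CommutativeMonoid.Sum +-0-commutativeMonoid
  using (sum; sum-remove; sum-syntax)
open import Data.Fin using (Fin; zero; suc; _≟_; punchIn)
open import Data.Fin.Properties using (¬Fin0)
open import Data.Fin.Subset using (Subset; Empty; ∣_∣; _∩_; _─_; _∈_; _∉_; inside; outside)
open import Data.Fin.Subset.Properties
  using (nonempty?; Empty-unique; ∣⊥∣≡0; ∣⁅x⁆∣≡1; x∈⁅y⁆⇔x≡y; p⊆q⇒∣p∣≤∣q∣; ∣p∩q∣≤∣q∣;
         x∈p∩q⁺; x∈p∩q⁻; p─q⊆p)
open import Data.Vec using ([]; _∷_)
open import Data.Vec.Base using (here; there)
open import Data.Vec.Functional using (removeAt)
open import Data.Product using (∃; _,_; proj₁; proj₂)
open import Data.Sum using (inj₁)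
open import Data.Empty using (⊥-elim)
open import Function using (_∘_; case_of_; Equivalence)
open import Relation.Nullary using (¬_; yes; no)
open import Relation.Binary.PropositionalEquality using (_≡_; _≢_; refl; sym; trans; cong; subst)

private
  variable
    n k : ℕ

∑≤n : (f : Fin n → ℕ) → (∀ i → f i ≤ 1) → ∑[ i < n ] f i ≤ n
∑≤n {zero}  f f≤1 = z≤n
∑≤n {suc n} f f≤1 = +-mono-≤ (f≤1 zero) (∑≤n (f ∘ suc) (f≤1 ∘ suc))

-- Removing the i-th term leaves n ∸ 1 terms, each at most 1, so f i must make up the rest.
∑≥n⇒≡1 : (f : Fin n → ℕ) → (∀ i → f i ≤ 1) → n ≤ ∑[ i < n ] f i → ∀ i → f i ≡ 1
∑≥n⇒≡1 {suc n} f f≤1 n≤∑f i = ≤-antisym (f≤1 i) (+-cancelʳ-≤ n 1 (f i) (begin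
  suc n                         ≤⟨ n≤∑f ⟩
  ∑[ j < suc n ] f j            ≡⟨ sum-remove {i = i} f ⟩
  f i + sum (removeAt f i)      ≤⟨ +-monoʳ-≤ (f i) (∑≤n (removeAt f i) (f≤1 ∘ punchIn i)) ⟩
  f i + n                       ∎))
  where open ≤-Reasoning

∣p∣≡0 : {p : Subset n} → Empty p → ∣ p ∣ ≡ 0
∣p∣≡0 {n} empty = trans (cong ∣_∣ (Empty-unique empty)) (∣⊥∣≡0 n)

∣p∣≡∣p∩q∣+∣p─q∣ : (p q : Subset n) → ∣ p ∣ ≡ ∣ p ∩ q ∣ + ∣ p ─ q ∣
∣p∣≡∣p∩q∣+∣p─q∣ []            []            = refl
∣p∣≡∣p∩q∣+∣p─q∣ (outside ∷ p) (inside  ∷ q) = ∣p∣≡∣p∩q∣+∣p─q∣ p q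
∣p∣≡∣p∩q∣+∣p─q∣ (outside ∷ p) (outside ∷ q) = ∣p∣≡∣p∩q∣+∣p─q∣ p q
∣p∣≡∣p∩q∣+∣p─q∣ (inside  ∷ p) (inside  ∷ q) = cong suc (∣p∣≡∣p∩q∣+∣p─q∣ p q)
∣p∣≡∣p∩q∣+∣p─q∣ (inside  ∷ p) (outside ∷ q) =
  trans (cong suc (∣p∣≡∣p∩q∣+∣p─q∣ p q)) (sym (+-suc _ _))

x∈p─q⇒x∉q : ∀ {x : Fin n} (p q : Subset n) → x ∈ p ─ q → x ∉ q
x∈p─q⇒x∉q (_ ∷ p) (outside ∷ q) here        ()
x∈p─q⇒x∉q (_ ∷ p) (_       ∷ q) (there x∈p─q) (there x∈q) = x∈p─q⇒x∉q p q x∈p─q x∈q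

∣p∣≤∑∣qᵢ∣ : (p : Subset n) (q : Fin k → Subset n) →
            (∀ {x} → x ∈ p → ∃ λ i → x ∈ q i) → ∣ p ∣ ≤ ∑[ i < k ] ∣ q i ∣
∣p∣≤∑∣qᵢ∣ {k = zero}  p q cover =
  ≤-reflexive (∣p∣≡0 λ (x , x∈p) → ¬Fin0 (proj₁ (cover x∈p)))
∣p∣≤∑∣qᵢ∣ {k = suc k} p q cover = begin
  ∣ p ∣                            ≡⟨ ∣p∣≡∣p∩q∣+∣p─q∣ p (q zero) ⟩
  ∣ p ∩ q zero ∣ + ∣ p ─ q zero ∣  ≤⟨ +-mono-≤ (∣p∩q∣≤∣q∣ p (q zero))
                                               (∣p∣≤∑∣qᵢ∣ (p ─ q zero) (q ∘ suc) cover′) ⟩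
  ∑[ i < suc k ] ∣ q i ∣           ∎
  where
  open ≤-Reasoning
  cover′ : ∀ {x} → x ∈ p ─ q zero → ∃ λ i → x ∈ q (suc i)
  cover′ x∈p─q₀ with cover (p─q⊆p p (q zero) x∈p─q₀)
  ... | zero  , x∈q₀ = ⊥-elim (x∈p─q⇒x∉q p (q zero) x∈p─q₀ x∈q₀)
  ... | suc i , x∈qᵢ = i , x∈qᵢ

∣p∣≤1 : {p : Subset n} → (∀ {x y} → x ∈ p → y ∈ p → x ≡ y) → ∣ p ∣ ≤ 1
∣p∣≤1 {p = p} subsingleton with nonempty? p
... | yes (x , x∈p) = subst (∣ p ∣ ≤_) (∣⁅x⁆∣≡1 x)
                        (p⊆q⇒∣p∣≤∣q∣ λ y∈p → Equivalence.from x∈⁅y⁆⇔x≡y (subsingleton y∈p x∈p))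
... | no  empty     = subst (_≤ 1) (sym (∣p∣≡0 empty)) z≤n

IsStable : Graph n → Subset n → Set
IsStable H S = ∀ u v → u ∈ S → v ∈ S → ¬ H u v

IsClique-mono : {H H′ : Graph n} {C : Subset n} →
                (∀ {u v} → H u v → H′ u v) → IsClique H C → IsClique H′ C
IsClique-mono H⇒H′ clique u v u∈C v∈C u≢v = H⇒H′ (clique u v u∈C v∈C u≢v)

∣clique∩stable∣≤1 : {H : Graph n} {C S : Subset n} →
                    IsClique H C → IsStable H S → ∣ C ∩ S ∣ ≤ 1
∣clique∩stable∣≤1 {C = C} {S} clique stable = ∣p∣≤1 λ {u} {v} u∈C∩S v∈C∩S →
  let u∈C , u∈S = x∈p∩q⁻ C S u∈C∩S
      v∈C , v∈S = x∈p∩q⁻ C S v∈C∩S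
  in case u ≟ v of λ where
       (yes u≡v) → u≡v
       (no  u≢v) → ⊥-elim (stable u v u∈S v∈S (clique u v u∈C v∈C u≢v))

clique∩class≡1 : {H : Graph n} {C : Subset n} {P : Fin k → Subset n} →
                 IsClique H C → ∣ C ∣ ≡ k → (∀ {u} → u ∈ C → ∃ λ i → u ∈ P i) →
                 (∀ i → IsStable H (P i)) → ∀ i → ∣ C ∩ P i ∣ ≡ 1
clique∩class≡1 {C = C} {P} clique ∣C∣≡k cover stable =
  ∑≥n⇒≡1 (λ i → ∣ C ∩ P i ∣) (λ i → ∣clique∩stable∣≤1 clique (stable i))
    (subst (_≤ ∑[ i < _ ] ∣ C ∩ P i ∣) ∣C∣≡k (∣p∣≤∑∣qᵢ∣ C (λ i → C ∩ P i) cover′))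
  where
  cover′ : ∀ {u} → u ∈ C → ∃ λ i → u ∈ C ∩ P i
  cover′ u∈C = let i , u∈Pᵢ = cover u∈C in i , x∈p∩q⁺ (u∈C , u∈Pᵢ)

iterProj-mono : (G : Graph n) (W : ℕ → Subset n) {a b : ℕ} → a ≤′ b →
                ∀ {u v} → iterProj G W a u v → iterProj G W b u v
iterProj-mono G W ≤′-refl        edge = edge
iterProj-mono G W (≤′-step a≤′b) edge = inj₁ (iterProj-mono G W a≤′b edge)

lemma8 : (n : ℕ) (G : Graph n) → IsSimple G →
         (r : ℕ) (W : ℕ → Subset n) →
         (∀ i j → 1 ≤ i → i ≤ r → 1 ≤ j → j ≤ r → i ≢ j → W i ≢ W j) →
         (∀ t → 1 ≤ t → t ≤ r → IsClique (iterProj G W (t ∸ 1)) (W t)) →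
         (∀ t → 1 ≤ t → t ≤ r → 2 ≤ ∣ W t ∣) →
         (k : ℕ) → 0 < k →
         (P : ℕ → Fin k → Subset n) →
         (∀ t → 1 ≤ t → t ≤ r → ∣ W t ∣ ≡ k) →
         (∀ t → 1 ≤ t → t ≤ r →
            IsKPartiteInduced k (iterProj G W (t ∸ 1)) (InUnion W t) (P t)) →
         ∀ t → 1 ≤ t → t ≤ r →
         ∀ ℓ → 1 ≤ ℓ → ℓ ≤ t → (i : Fin k) → ∣ W ℓ ∩ P t i ∣ ≡ 1
lemma8 n G _ r W _ clique _ k _ P ∣W∣≡k partite t 1≤t t≤r ℓ 1≤ℓ ℓ≤t =
  clique∩class≡1 Wℓ-clique (∣W∣≡k ℓ 1≤ℓ ℓ≤r) (λ u∈Wℓ → cover _ (ℓ , 1≤ℓ , ℓ≤t , u∈Wℓ)) stable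
  where
  ℓ≤r : ℓ ≤ r
  ℓ≤r = ≤-trans ℓ≤t t≤r
  cover : ∀ u → InUnion W t u → ∃ λ i → u ∈ P t i
  cover = proj₁ (partite t 1≤t t≤r)
  stable : ∀ i → IsStable (iterProj G W (t ∸ 1)) (P t i)
  stable = proj₂ (proj₂ (proj₂ (partite t 1≤t t≤r)))
  Wℓ-clique : IsClique (iterProj G W (t ∸ 1)) (W ℓ)
  Wℓ-clique = IsClique-mono (iterProj-mono G W (≤⇒≤′ (∸-monoˡ-≤ 1 ℓ≤t))) (clique ℓ 1≤ℓ ℓ≤r)
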